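{- Let $\alpha>1$. If a class $\mathcal{F}$ of graphs admits a constant-size $\alpha$-ADT sketch, then $\mathcal{F}$ admits a constant-size distance-invariant $\alpha$-ADT sketch.
   Context: An $\alpha$-ADT sketch of size $s(n)$ for $\mathcal{F}$: for every $r\in\mathbb{N}$ there is a function $D_r:\{0,1\}^*\times\{0,1\}^*\to\{0,1\}$ such that for every $G\in\mathcal{F}$ with $n$ vertices there is a probability distribution over functions $\mathsf{sk}:V(G)\to\{0,1\}^{s(n)}$ such that for all $x,y\in V(G)$: $\mathsf{dist}_G(x,y)\le r$ implies $\Pr[D_r(\mathsf{sk}(x),\mathsf{sk}(y))=1]\ge2/3$, and $\mathsf{dist}_G(x,y)>\alpha r$ implies $\Pr[D_r(\mathsf{sk}(x),\mathsf{sk}(y))=0]\ge2/3$. The distribution may depend on $r$, but the size $s(n)$ does not. Constant-size means $s(n)$ does not depend on $n$ (nor on $r$). The sketch is distance-invariant if $D_r=D_{r'}$ for all $r,r'$.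
   Formalization: The parameter α ranges over the rationals, and the probability distributions over the functions $\mathsf{sk}$ have rational weights. -}

module Defs where

open import Data.Nat using (ℕ; zero; suc; _≤_)
open import Data.Integer using (+_)
open import Data.Rational as ℚ using (ℚ; 0ℚ; 1ℚ; _/_; _+_; _*_; _<_)
open import Data.Bool using (Bool; true; false; if_then_else_)
open import Data.Fin using (Fin)
open import Data.Vec using (Vec; toList)
open import Data.List using (List; []; _∷_)
open import Data.List.Relation.Unary.All using (All)
open import Data.Product using (Σ; ∃; _×_; _,_; proj₁; proj₂)
open import Relation.Binary.PropositionalEquality using (_≡_)

record Graph : Set where
  field
    n      : ℕ
    adj    : Fin n → Fin n → Bool
    sym    : ∀ i j → adj i j ≡ adj j i
    irrefl : ∀ i → adj i i ≡ false
open Graph public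

data Walk (G : Graph) : Fin (n G) → Fin (n G) → ℕ → Set where
  here : ∀ {x} → Walk G x x 0
  step : ∀ {x y z k} → adj G x y ≡ true → Walk G y z k → Walk G x z (suc k)

DistLe : (G : Graph) → Fin (n G) → Fin (n G) → ℕ → Set
DistLe G x y r = ∃ λ k → k ≤ r × Walk G x y k

-- dist_G(x,y) > α r   (dist = ∞ if disconnected, in which case this holds)
DistGt : (α : ℚ) (G : Graph) → Fin (n G) → Fin (n G) → ℕ → Set
DistGt α G x y r = ∀ k → Walk G x y k → α * ((+ r) / 1) < (+ k) / 1

-- A finitely supported probability distribution over sketch functions
-- sk : V(G) → {0,1}^s, given as a list of (weight, function) pairs.
Distr : ℕ → ℕ → Set
Distr s m = List (ℚ × (Fin m → Vec Bool s))

weightSum : ∀ {s m} → Distr s m → ℚ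
weightSum []             = 0ℚ
weightSum ((w , _) ∷ μ) = w + weightSum μ

IsDistr : ∀ {s m} → Distr s m → Set
IsDistr μ = All (λ p → 0ℚ ℚ.≤ proj₁ p) μ × weightSum μ ≡ 1ℚ

Decoder : Set
Decoder = List Bool → List Bool → Bool

eqB : Bool → Bool → Bool
eqB true  true  = true
eqB false false = true
eqB _     _     = false

Pr : ∀ {s m} → Decoder → Distr s m → Fin m → Fin m → Bool → ℚ
Pr D [] x y b = 0ℚ
Pr D ((w , sk) ∷ μ) x y b =
  (if eqB (D (toList (sk x)) (toList (sk y))) b then w else 0ℚ) + Pr D μ x y b

twoThirds : ℚ
twoThirds = (+ 2) / 3

IsADTSketch : (α : ℚ) (F : Graph → Set) (s : ℕ → ℕ) (D : ℕ → Decoder) → Set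
IsADTSketch α F s D =
  ∀ (r : ℕ) (G : Graph) → F G →
  Σ (Distr (s (n G)) (n G)) λ μ →
    IsDistr μ ×
    (∀ x y →
      (DistLe G x y r → twoThirds ℚ.≤ Pr (D r) μ x y true) ×
      (DistGt α G x y r → twoThirds ℚ.≤ Pr (D r) μ x y false))

HasConstSizeADTSketch : ℚ → (Graph → Set) → Set
HasConstSizeADTSketch α F =
  Σ ℕ λ c → Σ (ℕ → Decoder) λ D → IsADTSketch α F (λ _ → c) D

HasConstSizeInvariantADTSketch : ℚ → (Graph → Set) → Set
HasConstSizeInvariantADTSketch α F =
  Σ ℕ λ c → Σ Decoder λ D → IsADTSketch α F (λ _ → c) (λ _ → D)

{-# OPTIONS --safe #-}
-- Next to its c bits, every sketch can also carry the whole truth table of D_r on pairs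
-- of c-bit strings: 2^(2c) more bits, a number depending on neither n nor r.
-- One fixed decoder then answers D_r(sk x, sk y) by looking up the key (sk x, sk y)
-- in the table carried by x, so every probability, and with it correctness, is
-- unchanged.
module Submission where

open import Defs hiding (sym)
open import Data.Rational using (ℚ; 1ℚ; _<_)
import Data.Rational as ℚ
open import Data.Nat using (ℕ; zero; suc; _+_)
open import Data.Bool using (Bool; true; false; if_then_else_)
open import Data.Vec using (Vec; []; _∷_; _++_; toList; take; drop)
open import Data.Vec.Properties using (toList-++; take++drop≡id; ++-injectiveˡ; ++-injectiveʳ)
open import Data.List as List using (List)
import Data.List.Relation.Unary.All.Properties as All
open import Data.Product using (Σ; _,_; map₂)
open import Function using (_∘_)
open import Relation.Binary.PropositionalEquality
  using (_≡_; refl; sym; trans; cong; cong₂; subst; module ≡-Reasoning)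

tableSize : ℕ → ℕ
tableSize zero    = 1
tableSize (suc k) = tableSize k + tableSize k

toTable : ∀ k → (Vec Bool k → Bool) → Vec Bool (tableSize k)
toTable zero    f = f [] ∷ []
toTable (suc k) f = toTable k (f ∘ (true ∷_)) ++ toTable k (f ∘ (false ∷_))

-- Decoders see sketches as lists, so the lookup is on lists; malformed input yields false.
lookupTable : ℕ → List Bool → List Bool → Bool
lookupTable zero    _                 (b List.∷ _) = b
lookupTable zero    _                 List.[]      = false
lookupTable (suc k) (true  List.∷ key) table = lookupTable k key (List.take (tableSize k) table)
lookupTable (suc k) (false List.∷ key) table = lookupTable k key (List.drop (tableSize k) table)
lookupTable (suc k) List.[]            _     = false

module _ {a} {A : Set a} where

  take-toList-++ : ∀ {k m} (u : Vec A k) (v : Vec A m) → List.take k (toList (u ++ v)) ≡ toList u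
  take-toList-++ []      v = refl
  take-toList-++ (x ∷ u) v = cong (x List.∷_) (take-toList-++ u v)

  drop-toList-++ : ∀ {k m} (u : Vec A k) (v : Vec A m) → List.drop k (toList (u ++ v)) ≡ toList v
  drop-toList-++ []      v = refl
  drop-toList-++ (x ∷ u) v = drop-toList-++ u v

  take-++ : ∀ {k m} (u : Vec A k) (v : Vec A m) → take k (u ++ v) ≡ u
  take-++ {k} u v = ++-injectiveˡ (take k (u ++ v)) u (take++drop≡id k (u ++ v))

  drop-++ : ∀ {k m} (u : Vec A k) (v : Vec A m) → drop k (u ++ v) ≡ v
  drop-++ {k} u v = ++-injectiveʳ (take k (u ++ v)) u (take++drop≡id k (u ++ v))

lookupTable-toTable : ∀ k (f : Vec Bool k → Bool) (v : Vec Bool k) →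
                      lookupTable k (toList v) (toList (toTable k f)) ≡ f v
lookupTable-toTable zero    f []          = refl
lookupTable-toTable (suc k) f (true ∷ v)  = begin
  lookupTable k (toList v) (List.take (tableSize k) (toList (toTable (suc k) f)))
    ≡⟨ cong (lookupTable k (toList v)) (take-toList-++ (toTable k (f ∘ (true ∷_))) _) ⟩
  lookupTable k (toList v) (toList (toTable k (f ∘ (true ∷_))))
    ≡⟨ lookupTable-toTable k (f ∘ (true ∷_)) v ⟩
  f (true ∷ v) ∎
  where open ≡-Reasoning
lookupTable-toTable (suc k) f (false ∷ v) = begin
  lookupTable k (toList v) (List.drop (tableSize k) (toList (toTable (suc k) f)))
    ≡⟨ cong (lookupTable k (toList v)) (drop-toList-++ (toTable k (f ∘ (true ∷_))) _) ⟩
  lookupTable k (toList v) (toList (toTable k (f ∘ (false ∷_))))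
    ≡⟨ lookupTable-toTable k (f ∘ (false ∷_)) v ⟩
  f (false ∷ v) ∎
  where open ≡-Reasoning

Simulates : ∀ {s t} → Decoder → Decoder → (Vec Bool s → Vec Bool t) → Set
Simulates D′ D g = ∀ u v → D′ (toList (g u)) (toList (g v)) ≡ D (toList u) (toList v)

module _ (c : ℕ) where

  pairTable : Decoder → Vec Bool (c + c) → Bool
  pairTable D w = D (toList (take c w)) (toList (drop c w))

  withTable : Decoder → Vec Bool c → Vec Bool (c + tableSize (c + c))
  withTable D u = u ++ toTable (c + c) (pairTable D)

  tableDecoder : Decoder
  tableDecoder l₁ l₂ = lookupTable (c + c) (List.take c l₁ List.++ List.take c l₂) (List.drop c l₁)

  tableDecoder-withTable : ∀ D → Simulates tableDecoder D (withTable D)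
  tableDecoder-withTable D u v = begin
    tableDecoder (toList (u ++ table)) (toList (v ++ table))
      ≡⟨ cong₂ (λ key tab → lookupTable (c + c) key tab)
               (cong₂ List._++_ (take-toList-++ u table) (take-toList-++ v table))
               (drop-toList-++ u table) ⟩
    lookupTable (c + c) (toList u List.++ toList v) (toList table)
      ≡⟨ cong (λ key → lookupTable (c + c) key (toList table)) (toList-++ u v) ⟨
    lookupTable (c + c) (toList (u ++ v)) (toList table)
      ≡⟨ lookupTable-toTable (c + c) (pairTable D) (u ++ v) ⟩
    D (toList (take c (u ++ v))) (toList (drop c (u ++ v)))
      ≡⟨ cong₂ (λ u′ v′ → D (toList u′) (toList v′)) (take-++ u v) (drop-++ u v) ⟩
    D (toList u) (toList v) ∎
    where
      open ≡-Reasoning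
      table = toTable (c + c) (pairTable D)

module _ {s t m : ℕ} (g : Vec Bool s → Vec Bool t) where

  mapSketches : Distr s m → Distr t m
  mapSketches = List.map (map₂ (g ∘_))

  weightSum-mapSketches : (μ : Distr s m) → weightSum (mapSketches μ) ≡ weightSum μ
  weightSum-mapSketches List.[]            = refl
  weightSum-mapSketches ((w , _) List.∷ μ) = cong (w ℚ.+_) (weightSum-mapSketches μ)

  IsDistr-mapSketches : {μ : Distr s m} → IsDistr μ → IsDistr (mapSketches μ)
  IsDistr-mapSketches {μ} (nonneg , total) = All.map⁺ nonneg , trans (weightSum-mapSketches μ) total

  Pr-mapSketches : ∀ {D′ D} → Simulates D′ D g →
                   ∀ (μ : Distr s m) x y b → Pr D′ (mapSketches μ) x y b ≡ Pr D μ x y b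
  Pr-mapSketches sim List.[]             x y b = refl
  Pr-mapSketches sim ((w , sk) List.∷ μ) x y b =
    cong₂ ℚ._+_ (cong (λ d → if eqB d b then w else ℚ.0ℚ) (sim (sk x) (sk y)))
                (Pr-mapSketches sim μ x y b)

IsADTSketch-reencode : ∀ {α F s t D D′} →
  (∀ r m → Σ (Vec Bool (s m) → Vec Bool (t m)) (Simulates (D′ r) (D r))) →
  IsADTSketch α F s D → IsADTSketch α F t D′
IsADTSketch-reencode reencode sketch r G inF with sketch r G inF | reencode r (n G)
... | μ , isDistr , correct | g , sim =
  mapSketches g μ , IsDistr-mapSketches g isDistr ,
  λ x y → let close , far = correct x y in
    (λ le → subst (twoThirds ℚ.≤_) (sym (Pr-mapSketches g sim μ x y true)) (close le)) ,
    (λ gt → subst (twoThirds ℚ.≤_) (sym (Pr-mapSketches g sim μ x y false)) (far gt))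

proposition5p1 : (α : ℚ) → 1ℚ < α → (F : Graph → Set) →
    HasConstSizeADTSketch α F → HasConstSizeInvariantADTSketch α F
proposition5p1 α _ F (c , D , sketch) =
  c + tableSize (c + c) , tableDecoder c ,
  IsADTSketch-reencode {α} {F} (λ r _ → withTable c (D r) , tableDecoder-withTable c (D r)) sketch
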